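{- Let $j, k \in \mathbb{N}^+$ with $k > j$. Then $$B_{2k+j,k} = (k+j+3)\,2^{k+j-2} - (3j^2+19j+18)\,2^{j-4}.$$
   Context: For $n,k\in\mathbb{N}^+$, $B_{n,k}$ denotes the number of ways to split $n$ indistinguishable balls into any number of nonempty, ordered bins so that the most crowded bin contains exactly $k$ balls; equivalently, the number of compositions $(x_1,\dots,x_\ell)$ of $n$ (ordered tuples of positive integers of any length $\ell\ge 1$ summing to $n$) with $\max_i x_i = k$. -}

module Defs where

open import Data.Nat using (ℕ; zero; suc; _≤_; _⊔_; _≟_; _≤?_)
open import Data.Nat.ListAction using (sum)
open import Data.List using (List; []; _∷_; length; foldr; filter; concatMap; map; upTo)
open import Data.List.Relation.Unary.All using (All; all?)
open import Data.Product using (_×_)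
open import Relation.Nullary.Decidable using (Dec; _×-dec_)
open import Relation.Binary.PropositionalEquality using (_≡_)

IsComposition : ℕ → List ℕ → Set
IsComposition n xs = (1 ≤ length xs) × (All (λ x → 1 ≤ x) xs × (sum xs ≡ n))

-- largest part (0 for the empty list, which is never a composition)
maxPart : List ℕ → ℕ
maxPart = foldr _⊔_ 0

listsOfLength : ℕ → List ℕ → List (List ℕ)
listsOfLength zero    as = [] ∷ []
listsOfLength (suc ℓ) as = concatMap (λ a → map (a ∷_) (listsOfLength ℓ as)) as

-- every list of length ≤ n with entries in {0,…,n}; every composition of n
-- is among them (each part is ≤ n and there are at most n parts)
candidates : ℕ → List (List ℕ)
candidates n = concatMap (λ ℓ → listsOfLength ℓ (upTo (suc n))) (upTo (suc n))

isComposition? : (n : ℕ) (xs : List ℕ) → Dec (IsComposition n xs)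
isComposition? n xs = (1 ≤? length xs) ×-dec (all? (λ x → 1 ≤? x) xs ×-dec (sum xs ≟ n))

B : ℕ → ℕ → ℕ
B n k = length (filter (λ xs → isComposition? n xs ×-dec (maxPart xs ≟ k)) (candidates n))

-- Let C k n be the number of compositions of n with all parts at most k (C k 0 = 1).
-- Splitting off the first part gives C k (n+1) = Σ_{i < min(k, n+1)} C k (n - i), hence
-- C k (t+1) = 2^t for t < k and C k (n+1) + C k (n-k) = 2 C k n for n ≥ k.  Solving the
-- latter on two consecutive ranges gives
--   2 C k (k+1+t) + (t+2) 2^t = 2^(k+t+1)                        for t ≤ k,
--   8 C k (2k+1+s) + (k+s+2) 2^(k+s+2) = 2^(2k+s+3) + s(s+3) 2^s   for s ≤ k+1.
-- Since B n k = C k n - C (k-1) n for n ≥ 1, evaluating both closed forms at n = 2k+j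
-- (s = j-1 for k, s = j+1 for k-1) yields the formula.
module Submission where

open import Defs
open import Data.Nat using (ℕ; zero; suc; _+_; _*_; _^_; _∸_; _⊓_; _≤_; _<_; _≤′_; ≤′-refl; ≤′-step; z≤n; s≤s; _≤?_; _≟_)
open import Data.Nat.Properties
open import Data.Nat.ListAction using (sum)
open import Data.Nat.ListAction.Properties using (sum-++)
open import Data.Nat.Tactic.RingSolver using (solve)
open import Data.List using (List; []; _∷_; _++_; length; filter; concatMap; map; upTo; applyUpTo)
open import Data.List.Properties using (map-cong; length-++; filter-++; filter-≐; filter-none; applyUpTo-∷ʳ; map-upTo)
open import Data.List.Relation.Unary.All as All using (All; all?)
open import Data.Product using (_×_; _,_; proj₁; proj₂)
open import Data.Empty using (⊥-elim)
open import Function using (_∘_)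
open import Level using (0ℓ)
open import Relation.Nullary using (yes; no; ¬_)
open import Relation.Nullary.Decidable using (_×-dec_)
open import Relation.Unary using (Pred; Decidable; _≐_; _∩_; ∁)
open import Relation.Unary.Properties using (_∩?_; ∁?)
open import Relation.Binary.PropositionalEquality
open import Algebra.Properties.CommutativeSemigroup +-commutativeSemigroup using (interchange)

∑< : ℕ → (ℕ → ℕ) → ℕ
∑< n f = sum (applyUpTo f n)

syntax ∑< n (λ i → e) = ∑[ i < n ] e

∑-cong : ∀ n {f g : ℕ → ℕ} → (∀ {i} → i < n → f i ≡ g i) → ∑< n f ≡ ∑< n g
∑-cong zero    _  = refl
∑-cong (suc n) eq = cong₂ _+_ (eq (s≤s z≤n)) (∑-cong n (eq ∘ s≤s))

∑-zero : ∀ n {f : ℕ → ℕ} → (∀ {i} → i < n → f i ≡ 0) → ∑< n f ≡ 0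
∑-zero zero    _  = refl
∑-zero (suc n) eq = cong₂ _+_ (eq (s≤s z≤n)) (∑-zero n (eq ∘ s≤s))

∑-distrib-+ : ∀ n (f g : ℕ → ℕ) → ∑[ i < n ] (f i + g i) ≡ ∑< n f + ∑< n g
∑-distrib-+ zero    f g = refl
∑-distrib-+ (suc n) f g = trans (cong (f 0 + g 0 +_) (∑-distrib-+ n (f ∘ suc) (g ∘ suc)))
                                (interchange (f 0) (g 0) (∑< n (f ∘ suc)) (∑< n (g ∘ suc)))

∑-comm : ∀ m n (f : ℕ → ℕ → ℕ) → ∑[ i < m ] ∑[ j < n ] f i j ≡ ∑[ j < n ] ∑[ i < m ] f i j
∑-comm zero    n f = sym (∑-zero n (λ _ → refl))
∑-comm (suc m) n f = trans (cong (∑[ j < n ] f 0 j +_) (∑-comm m n (f ∘ suc)))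
                           (sym (∑-distrib-+ n (f 0) (λ j → ∑[ i < m ] f (suc i) j)))

∑-+ : ∀ m n (f : ℕ → ℕ) → ∑< (m + n) f ≡ ∑< m f + ∑[ i < n ] f (m + i)
∑-+ zero    n f = refl
∑-+ (suc m) n f = trans (cong (f 0 +_) (∑-+ m n (f ∘ suc))) (sym (+-assoc (f 0) _ _))

∑-last : ∀ n (f : ℕ → ℕ) → ∑< (suc n) f ≡ ∑< n f + f n
∑-last n f = begin
  sum (applyUpTo f (suc n))         ≡⟨ cong sum (applyUpTo-∷ʳ f n) ⟨
  sum (applyUpTo f n ++ f n ∷ [])   ≡⟨ sum-++ (applyUpTo f n) (f n ∷ []) ⟩
  ∑< n f + (f n + 0)                ≡⟨ cong (∑< n f +_) (+-identityʳ (f n)) ⟩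
  ∑< n f + f n                      ∎
  where open ≡-Reasoning

private variable A X : Set

count : {P : Pred A 0ℓ} → Decidable P → List A → ℕ
count P? xs = length (filter P? xs)

count-≐ : {P Q : Pred A 0ℓ} (P? : Decidable P) (Q? : Decidable Q) → P ≐ Q → ∀ xs → count P? xs ≡ count Q? xs
count-≐ P? Q? P≐Q xs = cong length (filter-≐ P? Q? P≐Q xs)

count-none : {P : Pred A 0ℓ} (P? : Decidable P) → (∀ x → ¬ P x) → ∀ xs → count P? xs ≡ 0
count-none P? ¬P xs = cong length (filter-none P? (All.universal ¬P xs))

count-split : {P Q : Pred A 0ℓ} (P? : Decidable P) (Q? : Decidable Q) →
              ∀ xs → count P? xs ≡ count (P? ∩? Q?) xs + count (P? ∩? ∁? Q?) xs
count-split P? Q? []       = refl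
count-split P? Q? (x ∷ xs) with P? x | Q? x
... | yes _ | yes _ = cong suc (count-split P? Q? xs)
... | yes _ | no  _ = trans (cong suc (count-split P? Q? xs)) (sym (+-suc _ _))
... | no  _ | _     = count-split P? Q? xs

count-concatMap : {P : Pred A 0ℓ} (P? : Decidable P) (f : X → List A) →
                  ∀ xs → count P? (concatMap f xs) ≡ sum (map (count P? ∘ f) xs)
count-concatMap P? f []       = refl
count-concatMap P? f (x ∷ xs) = begin
  length (filter P? (f x ++ concatMap f xs))            ≡⟨ cong length (filter-++ P? (f x) _) ⟩
  length (filter P? (f x) ++ filter P? (concatMap f xs)) ≡⟨ length-++ (filter P? (f x)) ⟩
  count P? (f x) + count P? (concatMap f xs)            ≡⟨ cong (count P? (f x) +_) (count-concatMap P? f xs) ⟩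
  sum (map (count P? ∘ f) (x ∷ xs))                     ∎
  where open ≡-Reasoning

count-map : {P : Pred A 0ℓ} (P? : Decidable P) (g : X → A) →
            ∀ xs → count P? (map g xs) ≡ count (P? ∘ g) xs
count-map P? g []       = refl
count-map P? g (x ∷ xs) with P? (g x)
... | yes _ = cong suc (count-map P? g xs)
... | no  _ = count-map P? g xs

-- Unlike IsComposition, this admits the empty list (as the composition of 0).
Composition≤ : ℕ → ℕ → List ℕ → Set
Composition≤ k m xs = All (λ x → 1 ≤ x) xs × sum xs ≡ m × maxPart xs ≤ k

composition≤? : (k m : ℕ) → Decidable (Composition≤ k m)
composition≤? k m xs = all? (λ x → 1 ≤? x) xs ×-dec (sum xs ≟ m ×-dec (maxPart xs ≤? k))

composition≤-∷⁻ : ∀ {k m a xs} → Composition≤ k m (a ∷ xs) → 1 ≤ a × a ≤ k ⊓ m × Composition≤ k (m ∸ a) xs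
composition≤-∷⁻ {a = a} {xs} (1≤a All.∷ pos , refl , max≤k) =
  1≤a , ⊓-glb (m⊔n≤o⇒m≤o a _ max≤k) (m≤m+n a (sum xs)) ,
  pos , sym (m+n∸m≡n a (sum xs)) , m⊔n≤o⇒n≤o a _ max≤k

composition≤-∷⁺ : ∀ {k m a xs} → 1 ≤ a → a ≤ k ⊓ m → Composition≤ k (m ∸ a) xs → Composition≤ k m (a ∷ xs)
composition≤-∷⁺ {k} {m} {a} 1≤a a≤k⊓m (pos , sum≡ , max≤k) =
  1≤a All.∷ pos ,
  trans (cong (a +_) sum≡) (m+[n∸m]≡n (≤-trans a≤k⊓m (m⊓n≤n k m))) ,
  ⊔-lub (≤-trans a≤k⊓m (m⊓n≤m k m)) max≤k

-- The number of compositions of m (parts ≤ k) with first part a, if F m′ counts those of m′.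
firstPart : (k m : ℕ) → (ℕ → ℕ) → ℕ → ℕ
firstPart k m F zero    = 0
firstPart k m F (suc i) with suc i ≤? k ⊓ m
... | yes _ = F (m ∸ suc i)
... | no  _ = 0

count-∷ : ∀ k m a xs →
          count (composition≤? k m) (map (a ∷_) xs) ≡ firstPart k m (λ m′ → count (composition≤? k m′) xs) a
count-∷ k m a xs = trans (count-map (composition≤? k m) (a ∷_) xs) (by-first-part a)
  where
  by-first-part : ∀ a → count (composition≤? k m ∘ (a ∷_)) xs ≡ firstPart k m (λ m′ → count (composition≤? k m′) xs) a
  by-first-part zero = count-none _ (λ _ c → 1+n≰n (proj₁ (composition≤-∷⁻ c))) xs
  by-first-part (suc i) with suc i ≤? k ⊓ m
  ... | yes a≤k⊓m = count-≐ _ _ ((λ c → proj₂ (proj₂ (composition≤-∷⁻ c))) , composition≤-∷⁺ (s≤s z≤n) a≤k⊓m) xs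
  ... | no  a≰k⊓m = count-none _ (λ _ c → a≰k⊓m (proj₁ (proj₂ (composition≤-∷⁻ c)))) xs

firstPart-inside : ∀ k m F {i} → suc i ≤ k ⊓ m → firstPart k m F (suc i) ≡ F (m ∸ suc i)
firstPart-inside k m F {i} i<w with suc i ≤? k ⊓ m
... | yes _   = refl
... | no  i≮w = ⊥-elim (i≮w i<w)

firstPart-outside : ∀ k m F {i} → k ⊓ m ≤ i → firstPart k m F (suc i) ≡ 0
firstPart-outside k m F {i} w≤i with suc i ≤? k ⊓ m
... | yes i<w = ⊥-elim (<-irrefl refl (≤-trans i<w w≤i))
... | no  _   = refl

firstPart-∑ : ∀ k m L (F : ℕ → ℕ → ℕ) a →
              ∑[ ℓ < L ] firstPart k m (F ℓ) a ≡ firstPart k m (λ m′ → ∑[ ℓ < L ] F ℓ m′) a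
firstPart-∑ k m L F zero    = ∑-zero L (λ _ → refl)
firstPart-∑ k m L F (suc i) with suc i ≤? k ⊓ m
... | yes _ = refl
... | no  _ = ∑-zero L (λ _ → refl)

firstPart-cong : ∀ k m {F G : ℕ → ℕ} → (∀ {m′} → m′ ≤ m → F m′ ≡ G m′) → ∀ a → firstPart k m F a ≡ firstPart k m G a
firstPart-cong k m eq zero    = refl
firstPart-cong k m eq (suc i) with suc i ≤? k ⊓ m
... | yes _ = eq (m∸n≤m m (suc i))
... | no  _ = refl

∑-firstPart : ∀ k {m n} (F : ℕ → ℕ) → m ≤ n → ∑[ a < suc n ] firstPart k m F a ≡ ∑[ i < k ⊓ m ] F (m ∸ suc i)
∑-firstPart k {m} {n} F m≤n = begin
  ∑[ i < n ] g i                          ≡⟨ cong (λ N → ∑< N g) (m+[n∸m]≡n w≤n) ⟨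
  ∑[ i < w + (n ∸ w) ] g i                ≡⟨ ∑-+ w (n ∸ w) g ⟩
  ∑[ i < w ] g i + ∑[ i < n ∸ w ] g (w + i) ≡⟨ cong₂ _+_ (∑-cong w (firstPart-inside k m F))
                                                         (∑-zero (n ∸ w) (λ _ → firstPart-outside k m F (m≤m+n w _))) ⟩
  ∑[ i < w ] F (m ∸ suc i) + 0            ≡⟨ +-identityʳ _ ⟩
  ∑[ i < w ] F (m ∸ suc i)                ∎
  where
  open ≡-Reasoning
  w = k ⊓ m
  g = λ i → firstPart k m F (suc i)
  w≤n = ≤-trans (m⊓n≤n k m) m≤n

-- Compositions of m into at most L parts, each at most k; C k m takes L = m, which is
-- no restriction since parts are positive.
comp≤ : (k L m : ℕ) → ℕ
comp≤ k zero    zero    = 1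
comp≤ k zero    (suc m) = 0
comp≤ k (suc L) zero    = 1
comp≤ k (suc L) (suc m) = ∑[ i < k ⊓ suc m ] comp≤ k L (m ∸ i)

comp≤-suc : ∀ k L m → comp≤ k (suc L) m ≡ comp≤ k 0 m + ∑[ i < k ⊓ m ] comp≤ k L (m ∸ suc i)
comp≤-suc k L zero    = cong (λ w → 1 + ∑[ i < w ] comp≤ k L (0 ∸ suc i)) (sym (⊓-zeroʳ k))
comp≤-suc k L (suc m) = refl

comp≤-stable : ∀ k {L m} → m ≤ L → comp≤ k (suc L) m ≡ comp≤ k L m
comp≤-stable k {zero}  {zero}  z≤n       = refl
comp≤-stable k {suc L} {zero}  z≤n       = refl
comp≤-stable k {suc L} {suc m} (s≤s m≤L) =
  ∑-cong (k ⊓ suc m) (λ {i} _ → comp≤-stable k (≤-trans (m∸n≤m m i) m≤L))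

C : ℕ → ℕ → ℕ
C k n = comp≤ k n n

comp≤-saturated : ∀ k {L m} → m ≤′ L → comp≤ k L m ≡ C k m
comp≤-saturated k ≤′-refl          = refl
comp≤-saturated k (≤′-step m≤′L) = trans (comp≤-stable k (≤′⇒≤ m≤′L)) (comp≤-saturated k m≤′L)

C-suc : ∀ k m → C k (suc m) ≡ ∑[ i < k ⊓ suc m ] C k (m ∸ i)
C-suc k m = ∑-cong (k ⊓ suc m) (λ {i} _ → comp≤-saturated k (≤⇒≤′ (m∸n≤m m i)))

module _ (k n : ℕ) where

  private
    lists : ℕ → List (List ℕ)
    lists ℓ = listsOfLength ℓ (upTo (suc n))

    cnt : ℕ → ℕ → ℕ
    cnt ℓ m = count (composition≤? k m) (lists ℓ)

  count-listsOfLength-zero : ∀ m → cnt 0 m ≡ comp≤ k 0 m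
  count-listsOfLength-zero zero    = refl
  count-listsOfLength-zero (suc m) = refl

  count-listsOfLength-suc : ∀ ℓ m → cnt (suc ℓ) m ≡ ∑[ a < suc n ] firstPart k m (λ m′ → cnt ℓ m′) a
  count-listsOfLength-suc ℓ m = begin
    cnt (suc ℓ) m                                               ≡⟨ count-concatMap (composition≤? k m) (λ a → map (a ∷_) (lists ℓ)) (upTo (suc n)) ⟩
    sum (map (λ a → count (composition≤? k m) (map (a ∷_) (lists ℓ))) (upTo (suc n)))
                                                                ≡⟨ cong sum (map-cong (λ a → count-∷ k m a (lists ℓ)) (upTo (suc n))) ⟩
    sum (map (firstPart k m (λ m′ → cnt ℓ m′)) (upTo (suc n)))   ≡⟨ cong sum (map-upTo (firstPart k m (λ m′ → cnt ℓ m′)) (suc n)) ⟩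
    ∑[ a < suc n ] firstPart k m (λ m′ → cnt ℓ m′) a             ∎
    where open ≡-Reasoning

  ∑-count-listsOfLength : ∀ L {m} → m ≤ n → ∑[ ℓ < suc L ] cnt ℓ m ≡ comp≤ k L m
  ∑-count-listsOfLength zero    {m} _   = trans (+-identityʳ _) (count-listsOfLength-zero m)
  ∑-count-listsOfLength (suc L) {m} m≤n = begin
    cnt 0 m + ∑[ ℓ < suc L ] cnt (suc ℓ) m
      ≡⟨ cong₂ _+_ (count-listsOfLength-zero m) (∑-cong (suc L) (λ {ℓ} _ → count-listsOfLength-suc ℓ m)) ⟩
    comp≤ k 0 m + ∑[ ℓ < suc L ] ∑[ a < suc n ] firstPart k m (cnt ℓ) a
      ≡⟨ cong (comp≤ k 0 m +_) (∑-comm (suc L) (suc n) (λ ℓ → firstPart k m (cnt ℓ))) ⟩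
    comp≤ k 0 m + ∑[ a < suc n ] ∑[ ℓ < suc L ] firstPart k m (cnt ℓ) a
      ≡⟨ cong (comp≤ k 0 m +_) (∑-cong (suc n) (λ {a} _ → firstPart-∑ k m (suc L) cnt a)) ⟩
    comp≤ k 0 m + ∑[ a < suc n ] firstPart k m (λ m′ → ∑[ ℓ < suc L ] cnt ℓ m′) a
      ≡⟨ cong (comp≤ k 0 m +_) (∑-cong (suc n) (λ {a} _ → firstPart-cong k m (λ m′≤m → ∑-count-listsOfLength L (≤-trans m′≤m m≤n)) a)) ⟩
    comp≤ k 0 m + ∑[ a < suc n ] firstPart k m (comp≤ k L) a
      ≡⟨ cong (comp≤ k 0 m +_) (∑-firstPart k (comp≤ k L) m≤n) ⟩
    comp≤ k 0 m + ∑[ i < k ⊓ m ] comp≤ k L (m ∸ suc i)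
      ≡⟨ comp≤-suc k L m ⟨
    comp≤ k (suc L) m ∎
    where open ≡-Reasoning

  count-candidates : count (composition≤? k n) (candidates n) ≡ C k n
  count-candidates = begin
    count (composition≤? k n) (candidates n)  ≡⟨ count-concatMap (composition≤? k n) lists (upTo (suc n)) ⟩
    sum (map (λ ℓ → cnt ℓ n) (upTo (suc n)))  ≡⟨ cong sum (map-upTo (λ ℓ → cnt ℓ n) (suc n)) ⟩
    ∑[ ℓ < suc n ] cnt ℓ n                    ≡⟨ ∑-count-listsOfLength n ≤-refl ⟩
    C k n                                     ∎
    where open ≡-Reasoning

module _ {k n : ℕ} where

  maxPart≡-composition≤ : 1 ≤ n → (Composition≤ (suc k) n ∩ (λ xs → maxPart xs ≡ suc k)) ≐ (λ xs → IsComposition n xs × maxPart xs ≡ suc k)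
  maxPart≡-composition≤ 1≤n = to , from
    where
    to : ∀ {xs} → Composition≤ (suc k) n xs × maxPart xs ≡ suc k → IsComposition n xs × maxPart xs ≡ suc k
    to {[]}    ((_ , 0≡n , _) , _) = ⊥-elim (1+n≰n (subst (1 ≤_) (sym 0≡n) 1≤n))
    to {_ ∷ _} ((pos , sum≡ , _) , max≡) = (s≤s z≤n , pos , sum≡) , max≡
    from : ∀ {xs} → IsComposition n xs × maxPart xs ≡ suc k → Composition≤ (suc k) n xs × maxPart xs ≡ suc k
    from ((_ , pos , sum≡) , max≡) = (pos , sum≡ , ≤-reflexive max≡) , max≡

  maxPart≢-composition≤ : (Composition≤ (suc k) n ∩ ∁ (λ xs → maxPart xs ≡ suc k)) ≐ Composition≤ k n
  maxPart≢-composition≤ = (λ ((pos , sum≡ , max≤) , max≢) → pos , sum≡ , ≤-pred (≤∧≢⇒< max≤ max≢))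
                        , (λ (pos , sum≡ , max≤) → (pos , sum≡ , m≤n⇒m≤1+n max≤) , <⇒≢ (s≤s max≤))

B+C≡C : ∀ k n → 1 ≤ n → B n (suc k) + C k n ≡ C (suc k) n
B+C≡C k n 1≤n = begin
  B n (suc k) + C k n                               ≡⟨ cong (B n (suc k) +_) (count-candidates k n) ⟨
  B n (suc k) + count (composition≤? k n) cs         ≡⟨ cong₂ _+_ (count-≐ (P? ∩? Q?) (λ xs → isComposition? n xs ×-dec (maxPart xs ≟ suc k)) (maxPart≡-composition≤ 1≤n) cs)
                                                                  (count-≐ (P? ∩? ∁? Q?) (composition≤? k n) maxPart≢-composition≤ cs) ⟨
  count (P? ∩? Q?) cs + count (P? ∩? ∁? Q?) cs      ≡⟨ count-split P? Q? cs ⟨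
  count P? cs                                       ≡⟨ count-candidates (suc k) n ⟩
  C (suc k) n                                       ∎
  where
  open ≡-Reasoning
  cs = candidates n
  P? = composition≤? (suc k) n
  Q? = λ xs → maxPart xs ≟ suc k

-- Arithmetic steps are certified as in a linear combination: to get x ≡ y from hypotheses
-- lᵢ ≡ rᵢ with x - y = Σ cᵢ (lᵢ - rᵢ), move the negative terms across so that
-- x + u ≡ y + v is a semiring identity (closed by the solver) and u ≡ v follows from the lᵢ ≡ rᵢ.
linear-combination : ∀ {x y u v : ℕ} → u ≡ v → x + u ≡ y + v → x ≡ y
linear-combination {x} {y} {u} u≡v eq = +-cancelʳ-≡ u x y (trans eq (cong (y +_) (sym u≡v)))

module _ (K : ℕ) where

  private
    k = suc K

  C-suc-prefix : ∀ {n} → n ≤ K → C k (suc n) ≡ ∑[ i < suc n ] C k (n ∸ i)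
  C-suc-prefix {n} n≤K = trans (C-suc k n) (cong (λ w → ∑[ i < suc w ] C k (n ∸ i)) (m≥n⇒m⊓n≡n n≤K))

  C-suc-window : ∀ {n} → K ≤ n → C k (suc n) ≡ ∑[ i < k ] C k (n ∸ i)
  C-suc-window {n} K≤n = trans (C-suc k n) (cong (λ w → ∑[ i < suc w ] C k (n ∸ i)) (m≤n⇒m⊓n≡m K≤n))

  C-double : ∀ {n} → n < K → C k (2 + n) ≡ 2 * C k (1 + n)
  C-double {n} n<K = begin
    C k (2 + n)                                ≡⟨ C-suc-prefix n<K ⟩
    C k (1 + n) + ∑[ i < suc n ] C k (n ∸ i)    ≡⟨ cong (C k (1 + n) +_) (C-suc-prefix (<⇒≤ n<K)) ⟨
    C k (1 + n) + C k (1 + n)                  ≡⟨ cong (C k (1 + n) +_) (+-identityʳ _) ⟨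
    2 * C k (1 + n)                            ∎
    where open ≡-Reasoning

  C-recurrence : ∀ m → C k (2 + m + K) + C k m ≡ 2 * C k (1 + m + K)
  C-recurrence m = begin
    C k (2 + m + K) + C k m                              ≡⟨ cong (_+ C k m) (C-suc-window (m≤n⇒m≤1+n (m≤n+m K m))) ⟩
    c + window + C k m                                   ≡⟨ +-assoc c window (C k m) ⟩
    c + (window + C k m)                                 ≡⟨ cong (λ i → c + (window + C k i)) (m+n∸n≡m m K) ⟨
    c + (window + C k (m + K ∸ K))                       ≡⟨ cong (c +_) (∑-last K (λ i → C k (m + K ∸ i))) ⟨
    c + ∑[ i < k ] C k (m + K ∸ i)                       ≡⟨ cong (c +_) (C-suc-window (m≤n+m K m)) ⟨
    c + c                                                ≡⟨ cong (c +_) (+-identityʳ c) ⟨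
    2 * c                                                ∎
    where
    open ≡-Reasoning
    c = C k (1 + m + K)
    window = ∑[ i < K ] C k (m + K ∸ i)

  C-pow : ∀ {t} → t ≤ K → C k (suc t) ≡ 2 ^ t
  C-pow {zero}  _   = C-suc-prefix z≤n
  C-pow {suc t} t<K = trans (C-double t<K) (cong (2 *_) (C-pow (<⇒≤ t<K)))

  C-range₂ : ∀ {t} → t ≤ k → 2 * C k (2 + t + K) + (t + 2) * 2 ^ t ≡ 4 * (2 ^ t * 2 ^ K)
  C-range₂ {zero}  _         = base (C k (2 + K)) (C k (1 + K)) (2 ^ K) (C-recurrence 0) (C-pow ≤-refl)
    where
    base : ∀ x y q → x + 1 ≡ 2 * y → y ≡ q → 2 * x + 2 * 1 ≡ 4 * (1 * q)
    base x y q e refl = linear-combination (cong (2 *_) (sym e)) (solve (x ∷ y ∷ []))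
  C-range₂ {suc t} (s≤s t≤K) =
    step (C k (3 + t + K)) (C k (suc t)) (C k (2 + t + K)) (2 ^ t) (2 ^ K)
         (C-recurrence (suc t)) (C-pow t≤K) (C-range₂ (m≤n⇒m≤1+n t≤K))
    where
    step : ∀ y z x p q → y + z ≡ 2 * x → z ≡ p → 2 * x + (t + 2) * p ≡ 4 * (p * q) →
           2 * y + (suc t + 2) * (2 * p) ≡ 4 * (2 * p * q)
    step y _ x p q e₁ refl e₂ =
      linear-combination (cong₂ _+_ (cong (2 *_) (sym e₁)) (cong (2 *_) (sym e₂)))
                         (solve (t ∷ y ∷ x ∷ p ∷ q ∷ []))

  C-range₃ : ∀ {s} → s ≤ suc k →
             8 * C k (3 + s + K + K) + (s + K + 3) * (8 * (2 ^ s * 2 ^ K))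
               ≡ 32 * (2 ^ s * 2 ^ K * 2 ^ K) + s * (s + 3) * 2 ^ s
  C-range₃ {zero}  _         = base (C k (3 + K + K)) (2 ^ K) (C-range₂ ≤-refl)
    where
    base : ∀ x q → 2 * x + (suc K + 2) * (2 * q) ≡ 4 * (2 * q * q) →
           8 * x + (K + 3) * (8 * (1 * q)) ≡ 32 * (1 * q * q) + 0
    base x q e = linear-combination (cong (4 *_) (sym e)) (solve (K ∷ x ∷ q ∷ []))
  C-range₃ {suc s} (s≤s s≤k) =
    step (C k (4 + s + K + K)) (C k (2 + s + K)) (C k (3 + s + K + K)) (2 ^ s) (2 ^ K)
         (C-recurrence (2 + s + K)) (C-range₂ s≤k) (C-range₃ (m≤n⇒m≤1+n s≤k))
    where
    step : ∀ y z x p q → y + z ≡ 2 * x → 2 * z + (s + 2) * p ≡ 4 * (p * q) →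
           8 * x + (s + K + 3) * (8 * (p * q)) ≡ 32 * (p * q * q) + s * (s + 3) * p →
           8 * y + (suc s + K + 3) * (8 * (2 * p * q)) ≡ 32 * (2 * p * q * q) + suc s * (suc s + 3) * (2 * p)
    step y z x p q e₁ e₂ e₃ =
      linear-combination (cong₂ _+_ (cong₂ _+_ (cong (8 *_) (sym e₁)) (cong (4 *_) e₂)) (cong (2 *_) (sym e₃)))
                         (solve (s ∷ K ∷ y ∷ z ∷ x ∷ p ∷ q ∷ []))

B-formula : ∀ {J K} → J ≤ K →
            16 * B (2 * (2 + K) + (1 + J)) (2 + K) + (3 * (1 + J) * (1 + J) + 19 * (1 + J) + 18) * 2 ^ (1 + J)
              ≡ (K + J + 6) * (32 * (2 ^ J * 2 ^ K))
B-formula {J} {K} J≤K =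
  combine (B n (2 + K)) (C (1 + K) n′) (C (2 + K) n″) (2 ^ J) (2 ^ K)
          (subst₂ (λ m m′ → B n (2 + K) + C (1 + K) m ≡ C (2 + K) m′) n≡n′ n≡n″ (B+C≡C (1 + K) n (s≤s z≤n)))
          (C-range₃ (1 + K) (m≤n⇒m≤1+n (m≤n⇒m≤1+n (m≤n⇒m≤1+n J≤K))))
          (C-range₃ K (s≤s (s≤s J≤K)))
  where
  n  = 2 * (2 + K) + (1 + J)
  n′ = 3 + (2 + J) + K + K
  n″ = 3 + J + (1 + K) + (1 + K)
  n≡n′ : 2 * (2 + K) + (1 + J) ≡ 3 + (2 + J) + K + K
  n≡n′ = solve (J ∷ K ∷ [])
  n≡n″ : 2 * (2 + K) + (1 + J) ≡ 3 + J + (1 + K) + (1 + K)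
  n≡n″ = solve (J ∷ K ∷ [])
  combine : ∀ b c a p q → b + c ≡ a →
            8 * a + (J + suc K + 3) * (8 * (p * (2 * q))) ≡ 32 * (p * (2 * q) * (2 * q)) + J * (J + 3) * p →
            8 * c + (2 + J + K + 3) * (8 * (2 * (2 * p) * q))
              ≡ 32 * (2 * (2 * p) * q * q) + (2 + J) * (2 + J + 3) * (2 * (2 * p)) →
            16 * b + (3 * suc J * suc J + 19 * suc J + 18) * (2 * p) ≡ (K + J + 6) * (32 * (p * q))
  combine b c a p q e₀ e₁ e₂ =
    linear-combination (cong₂ _+_ (cong₂ _+_ (cong (16 *_) (sym e₀)) (cong (2 *_) (sym e₁))) (cong (2 *_) e₂))
                       (solve (J ∷ K ∷ b ∷ c ∷ a ∷ p ∷ q ∷ []))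

mainTheorem3 : (j k : ℕ) → 0 < j → j < k →
    16 * B (2 * k + j) k + (3 * j * j + 19 * j + 18) * 2 ^ j ≡ (k + j + 3) * 2 ^ (k + j + 2)
mainTheorem3 (suc J) (suc (suc K)) _ (s≤s (s≤s J≤K)) =
  trans (B-formula J≤K) (sym (cong₂ _*_ factor power))
  where
  open ≡-Reasoning
  factor : 2 + K + (1 + J) + 3 ≡ K + J + 6
  factor = solve (J ∷ K ∷ [])
  exponent : 2 + K + (1 + J) + 2 ≡ 5 + (J + K)
  exponent = solve (J ∷ K ∷ [])
  power : 2 ^ (2 + K + (1 + J) + 2) ≡ 32 * (2 ^ J * 2 ^ K)
  power = begin
    2 ^ (2 + K + (1 + J) + 2)   ≡⟨ cong (2 ^_) exponent ⟩
    2 ^ (5 + (J + K))           ≡⟨ ^-distribˡ-+-* 2 5 (J + K) ⟩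
    32 * 2 ^ (J + K)            ≡⟨ cong (32 *_) (^-distribˡ-+-* 2 J K) ⟩
    32 * (2 ^ J * 2 ^ K)        ∎
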